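{- There exists a nearly finitary independence system that is not $k$-nearly finitary for any $k\in\mathbb N$.
   Context: An independence system is a pair $I=(E,\mathcal L)$ with $\mathcal L\subseteq 2^E$ such that $\emptyset\in\mathcal L$ and every subset of a member of $\mathcal L$ is in $\mathcal L$. Its bases are the inclusion-maximal members of $\mathcal L$. Its finitarization is $I^{\mathrm{fin}}=(E,\mathcal L^{\mathrm{fin}})$, where $S\in\mathcal L^{\mathrm{fin}}$ iff every finite subset of $S$ is in $\mathcal L$. $I$ is nearly finitary if whenever $F$ is a base of $I^{\mathrm{fin}}$, $B$ is a base of $I$ and $B\subseteq F$, the set $F\setminus B$ is finite. For an integer $k$, $I$ is $k$-nearly finitary if whenever $F$ is a base of $I^{\mathrm{fin}}$, $B$ is a base of $I$ and $B\subseteq F$, we have $|F\setminus B|\le k$. -}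

module Defs where

open import Level using (0ℓ)
open import Data.Nat using (ℕ; _≤_)
open import Data.List using (List; length)
open import Data.List.Membership.Propositional using (_∈_)
open import Data.Product using (Σ; _×_; ∃)
open import Relation.Nullary using (¬_)
open import Relation.Unary using (Pred; _⊆_; ∅)

Subset : Set → Set₁
Subset E = Pred E 0ℓ

listSet : {E : Set} → List E → Subset E
listSet xs = λ x → x ∈ xs

Finite : {E : Set} → Subset E → Set
Finite {E} S = Σ (List E) λ xs → S ⊆ listSet xs

AtMost : {E : Set} → ℕ → Subset E → Set
AtMost {E} k S = Σ (List E) λ xs → (length xs ≤ k) × (S ⊆ listSet xs)

_∖_ : {E : Set} → Subset E → Subset E → Subset E
(F ∖ B) x = F x × ¬ B x

record IndependenceSystem : Set₁ where
  field
    E      : Set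
    𝓛      : Subset E → Set
    ∅∈𝓛    : 𝓛 ∅
    down   : ∀ {S T : Subset E} → T ⊆ S → 𝓛 S → 𝓛 T

IsBase : {E : Set} → (Subset E → Set) → Subset E → Set₁
IsBase {E} 𝓛 S = 𝓛 S × (∀ (T : Subset E) → 𝓛 T → S ⊆ T → T ⊆ S)

-- The finitarization: S ∈ 𝓛fin iff every finite subset of S lies in 𝓛.
-- Finite subsets of S are exactly those of the form listSet xs with xs ⊆ S.
𝓛fin : {E : Set} → (Subset E → Set) → Subset E → Set
𝓛fin {E} 𝓛 S = ∀ (xs : List E) → listSet xs ⊆ S → 𝓛 (listSet xs)

module _ (I : IndependenceSystem) where
  open IndependenceSystem I

  NearlyFinitary : Set₁
  NearlyFinitary = ∀ (F B : Subset E) → IsBase (𝓛fin 𝓛) F → IsBase 𝓛 B → B ⊆ F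
                   → Finite (F ∖ B)

  KNearlyFinitary : ℕ → Set₁
  KNearlyFinitary k = ∀ (F B : Subset E) → IsBase (𝓛fin 𝓛) F → IsBase 𝓛 B → B ⊆ F
                      → AtMost k (F ∖ B)

module Submission where

-- The ground set is E = ℕ × ℕ, split into columns; the k-th
-- block X k = {(k , i) ∣ i ≤ k} is an initial segment of column k of size k+1.
-- A set is independent iff it is finite or misses some whole block.
--
--  * Every finite set is independent, so the finitarization is all of 2^E and
--    its only base is E itself.
--  * E is infinite, so no finite set is a base; the bases are exactly the
--    complements ∁ X k of the blocks.
--  * If B is a base inside ∁ X j, maximality forces E ∖ B ⊆ X j: so every
--    gap F ∖ B is finite (nearly finitary), yet the gap E ∖ ∁ X k is X k,
--    which has k+1 elements, so the system is not k-nearly finitary.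

open import Defs
open import Data.Nat using (ℕ; suc; _≤_; s≤s; z≤n; _≟_; _≤?_)
open import Data.Nat.ListAction using (sum)
open import Data.Nat.Properties using (m≤m+n; m≤n+m; ≤-trans; n≮n; 1+n≢n)
open import Data.Product using (Σ; _×_; _,_; proj₁; proj₂)
open import Data.Sum using (_⊎_; inj₁; inj₂)
open import Data.Unit using (⊤; tt)
open import Data.Empty using (⊥-elim)
open import Data.List using (List; []; _∷_; length; map; lookup; applyUpTo)
open import Data.List.Relation.Unary.Any using (here; there; index)
open import Data.List.Relation.Unary.Any.Properties using (lookup-index)
open import Data.List.Membership.Propositional using (_∈_; _∉_)
open import Data.List.Membership.Propositional.Properties using (∈-map⁺; ∈-applyUpTo⁺)
open import Data.Fin using (Fin; toℕ)
open import Data.Fin.Properties using (injective⇒≤; toℕ-injective; toℕ≤pred[n])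
open import Function.Definitions using (Injective)
open import Relation.Nullary using (¬_; yes; no)
open import Relation.Nullary.Decidable using (_×-dec_; decidable-stable)
open import Relation.Binary.PropositionalEquality using (_≡_; refl; sym; trans; cong)
open import Relation.Unary using (_⊆_; ∁; Decidable)

Infinite : Set → Set
Infinite E = ∀ (xs : List E) → Σ E λ e → e ∉ xs

-- If all finite sets are independent and E is infinite, a base is never
-- finite: a fresh element could be added to it.
finite-not-base : (I : IndependenceSystem) → let open IndependenceSystem I in
                  Infinite E → (∀ xs → 𝓛 (listSet xs)) →
                  ∀ {B} → IsBase 𝓛 B → ¬ Finite B
finite-not-base I infinite finite-indep {B} (_ , maximal) (xs , B⊆xs) =
  e∉xs (B⊆xs (maximal B+e B+e-indep inj₁ (inj₂ refl)))
  where
  open IndependenceSystem I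
  e : E
  e = proj₁ (infinite xs)
  e∉xs : e ∉ xs
  e∉xs = proj₂ (infinite xs)

  B+e : Subset E
  B+e x = B x ⊎ x ≡ e

  B+e⊆list : B+e ⊆ listSet (e ∷ xs)
  B+e⊆list (inj₁ x∈B)  = there (B⊆xs x∈B)
  B+e⊆list (inj₂ refl) = here refl

  B+e-indep : 𝓛 B+e
  B+e-indep = down B+e⊆list (finite-indep (e ∷ xs))

-- A base B contained in an independent set ∁ Y equals it, so everything
-- outside B (in particular every gap F ∖ B) lies in Y, for decidable Y.
gap-⊆ : ∀ {E} {𝓛 : Subset E → Set} {B Y : Subset E} → IsBase 𝓛 B →
        Decidable Y → 𝓛 (∁ Y) → B ⊆ ∁ Y → ∀ F → F ∖ B ⊆ Y
gap-⊆ (_ , maximal) Y? ∁Y-indep B⊆∁Y F {x} (_ , x∉B) =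
  decidable-stable (Y? x) λ x∉Y → x∉B (maximal (∁ _) ∁Y-indep B⊆∁Y x∉Y)

-- A list containing n distinct values g 0, …, g (n-1) has length ≥ n:
-- the positions of these values form an injection Fin n → Fin (length xs).
cover-length : ∀ {A : Set} {n} (g : Fin n → A) → Injective _≡_ _≡_ g →
               (xs : List A) → (∀ i → g i ∈ xs) → n ≤ length xs
cover-length g g-inj xs covered = injective⇒≤ position-injective
  where
  position-injective : Injective _≡_ _≡_ (λ i → index (covered i))
  position-injective {i} {j} same-position =
    g-inj (trans (lookup-index (covered i))
                 (trans (cong (lookup xs) same-position) (sym (lookup-index (covered j)))))

∈⇒≤sum : ∀ {n ns} → n ∈ ns → n ≤ sum ns
∈⇒≤sum {ns = m ∷ ms} (here refl) = m≤m+n m (sum ms)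
∈⇒≤sum {ns = m ∷ ms} (there n∈ms) = ≤-trans (∈⇒≤sum n∈ms) (m≤n+m (sum ms) m)

fresh-in-column : ∀ (a : ℕ) (xs : List (ℕ × ℕ)) → (a , suc (sum (map proj₂ xs))) ∉ xs
fresh-in-column a xs p = n≮n _ (∈⇒≤sum (∈-map⁺ proj₂ p))

ℕ²-infinite : Infinite (ℕ × ℕ)
ℕ²-infinite xs = (0 , _) , fresh-in-column 0 xs

X : ℕ → Subset (ℕ × ℕ)
X k (a , i) = (a ≡ k) × (i ≤ k)

X? : ∀ k → Decidable (X k)
X? k (a , i) = (a ≟ k) ×-dec (i ≤? k)

X-finite : ∀ k → Finite (X k)
X-finite k = applyUpTo (k ,_) (suc k) , λ { (refl , i≤k) → ∈-applyUpTo⁺ (k ,_) (s≤s i≤k) }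

-- X k has k+1 distinct elements (k , 0), …, (k , k).
block-large : ∀ k → ¬ AtMost k (X k)
block-large k (xs , length≤k , X⊆xs) = n≮n k (≤-trans (cover-length g g-inj xs covered) length≤k)
  where
  g : Fin (suc k) → ℕ × ℕ
  g i = k , toℕ i
  g-inj : Injective _≡_ _≡_ g
  g-inj eq = toℕ-injective (cong proj₂ eq)
  covered : ∀ i → g i ∈ xs
  covered i = X⊆xs (refl , toℕ≤pred[n] i)

L : Subset (ℕ × ℕ) → Set
L S = Finite S ⊎ Σ ℕ λ k → S ⊆ ∁ (X k)

I : IndependenceSystem
I = record
  { E = ℕ × ℕ ; 𝓛 = L ; ∅∈𝓛 = inj₁ ([] , λ ())
  ; down = λ { T⊆S (inj₁ (xs , S⊆xs)) → inj₁ (xs , λ t → S⊆xs (T⊆S t))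
             ; T⊆S (inj₂ (k , S⊆∁X)) → inj₂ (k , λ t → S⊆∁X (T⊆S t)) } }

finite-independent : ∀ xs → L (listSet xs)
finite-independent xs = inj₁ (xs , λ x∈xs → x∈xs)

-- Every set is finitarily independent, so the whole ground set is the base
-- of the finitarization.
whole : Subset (ℕ × ℕ)
whole _ = ⊤

whole-fin-base : IsBase (𝓛fin L) whole
whole-fin-base = (λ xs _ → finite-independent xs) , λ _ _ _ _ → tt

-- The complement of a block is a base: it is infinite (it contains column
-- k+1), and it meets every other block, so it lies in no larger independent set.
complement-base : ∀ k → IsBase L (∁ (X k))
complement-base k = inj₂ (k , λ x∉X → x∉X) , maximal
  where
  maximal : ∀ T → L T → ∁ (X k) ⊆ T → T ⊆ ∁ (X k)
  maximal T (inj₁ (xs , T⊆xs)) ∁X⊆T _ =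
    ⊥-elim (fresh-in-column (suc k) xs (T⊆xs (∁X⊆T λ { (k+1≡k , _) → 1+n≢n k+1≡k })))
  maximal T (inj₂ (j , T⊆∁Xj)) ∁X⊆T t with j ≟ k
  ... | yes refl = T⊆∁Xj t
  ... | no j≢k  = ⊥-elim (T⊆∁Xj (∁X⊆T λ { (j≡k , _) → j≢k j≡k }) (refl , z≤n))

-- A base of I is never finite, so it lies in some ∁ (X j); then every gap
-- F ∖ B lies in the finite block X j.
nearly-finitary : NearlyFinitary I
nearly-finitary F B _ B-base _ with B-base
... | inj₁ B-finite , _ = ⊥-elim (finite-not-base I ℕ²-infinite finite-independent B-base B-finite)
... | inj₂ (j , B⊆∁Xj) , _ =
  let xs , X⊆xs = X-finite j in
  xs , λ gap → X⊆xs (gap-⊆ B-base (X? j) (inj₂ (j , λ x∉X → x∉X)) B⊆∁Xj F gap)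

-- The gap between the base whole of the finitarization and the base ∁ (X k)
-- contains X k, which has k+1 elements.
not-k-nearly-finitary : ∀ k → ¬ KNearlyFinitary I k
not-k-nearly-finitary k k-nf
  with xs , length≤k , gap⊆xs ← k-nf whole (∁ (X k)) whole-fin-base (complement-base k) (λ _ → tt)
  = block-large k (xs , length≤k , λ x∈X → gap⊆xs (tt , λ x∉X → x∉X x∈X))

theorem4p2p1 : Σ IndependenceSystem λ I → NearlyFinitary I × (∀ (k : ℕ) → ¬ KNearlyFinitary I k)
theorem4p2p1 = I , nearly-finitary , not-k-nearly-finitary
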